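{- For every graph $G$ there exists an optimal strategy for Dominator in the edge domination game on $G$ such that, in every play $S$ in which Dominator follows it, every Dominator move $s_i$ ($i$ odd) covers exactly two new vertices, i.e. $|C_{S,i}\setminus C_{S,i-1}|=2$ for every odd $i\leq |S|$.
   Context: For an edge $e$ of a graph $G$, $N[e]$ denotes $e$ together with all edges sharing an endpoint with $e$. In the edge domination game on $G$, Dominator and Staller alternately choose edges, Dominator first (Dominator makes the odd-numbered moves); each chosen edge $s_i$ must satisfy $N[s_i]\setminus\bigcup_{j<i}N[s_j]\neq\emptyset$; the game ends when all edges lie in $\bigcup_jN[s_j]$. Dominator minimizes and Staller maximizes the number of moves; an optimal strategy for Dominator guarantees at most $\gamma_{e,g}(G)$ moves, the value under optimal play. For a play $S$, $C_{S,i}$ is the set of endpoints of $s_1,\dots,s_i$, $C_{S,0}=\emptyset$. -}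

module Defs where

open import Data.Nat using (ℕ; zero; suc; _+_; _*_; _≤_)
open import Data.Bool using (Bool; true; false; _∨_)
open import Data.Fin using (Fin; _≟_)
open import Data.Fin.Subset using (Subset)
open import Data.Vec using (tabulate)
open import Data.List using (List; []; _∷_; _++_; [_]; length)
open import Data.Bool.ListAction using (any)
open import Data.List.Relation.Unary.Any using (Any)
open import Data.Product using (Σ; ∃; _×_; _,_; proj₁; proj₂)
open import Data.Sum using (_⊎_)
open import Data.Maybe using (Maybe; just)
open import Relation.Nullary using (¬_)
open import Relation.Nullary.Decidable using (⌊_⌋)
open import Relation.Binary.PropositionalEquality using (_≡_)

record Graph (n : ℕ) : Set where
  field
    adj    : Fin n → Fin n → Bool
    sym    : ∀ u v → adj u v ≡ adj v u
    irrefl : ∀ u → adj u u ≡ false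
open Graph public

module _ {n : ℕ} (G : Graph n) where

  -- An edge {u,v}, given by an ordered pair (u , v) with u ~ v.
  Edge : Set
  Edge = Σ (Fin n × Fin n) λ p → adj G (proj₁ p) (proj₂ p) ≡ true

  src tgt : Edge → Fin n
  src e = proj₁ (proj₁ e)
  tgt e = proj₂ (proj₁ e)

  -- A (partial) history of moves, in chronological order s₁ , s₂ , …
  History : Set
  History = List Edge

  _∈ₑ_ : Fin n → Edge → Set
  x ∈ₑ e = (x ≡ src e) ⊎ (x ≡ tgt e)

  _∈N[_] : Edge → Edge → Set
  f ∈N[ e ] = (src f ∈ₑ e) ⊎ (tgt f ∈ₑ e)

  Dominated : History → Edge → Set
  Dominated h f = Any (λ s → f ∈N[ s ]) h

  Legal : History → Edge → Set
  Legal h s = ∃ λ f → (f ∈N[ s ]) × ¬ Dominated h f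

  Finished : History → Set
  Finished h = ∀ f → Dominated h f

  -- Strategy of Dominator: given the history, propose a move
  -- (nothing is required where no move is possible, e.g. edgeless graphs).
  Strategy : Set
  Strategy = History → Maybe Edge

  -- Histories of legal play in which Dominator (odd moves) follows σ;
  -- Staller (even moves) plays any legal edge.
  data Follows (σ : Strategy) : History → Set where
    start   : Follows σ []
    dominator : ∀ {h e} → Follows σ h → (j : ℕ) → length h ≡ 2 * j →
                σ h ≡ just e → Legal h e → Follows σ (h ++ [ e ])
    staller : ∀ {h e} → Follows σ h → (j : ℕ) → length h ≡ suc (2 * j) →
              Legal h e → Follows σ (h ++ [ e ])

  ValidStrategy : Strategy → Set
  ValidStrategy σ = ∀ h → Follows σ h → (j : ℕ) → length h ≡ 2 * j →
                    ¬ Finished h → ∃ λ e → (σ h ≡ just e) × Legal h e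

  Guarantees : Strategy → ℕ → Set
  Guarantees σ k = ∀ h → Follows σ h → Finished h → length h ≤ k

  -- σ is optimal: it guarantees whatever any strategy guarantees,
  -- i.e. it guarantees at most γ_{e,g}(G) moves.
  Optimal : Strategy → Set
  Optimal σ = ValidStrategy σ ×
              (∀ τ k → ValidStrategy τ → Guarantees τ k → Guarantees σ k)

  C : History → Subset n
  C h = tabulate λ x → any (λ e → ⌊ x ≟ src e ⌋ ∨ ⌊ x ≟ tgt e ⌋) h

-- Call an edge fresh when neither of its endpoints is covered yet; playing a fresh edge covers exactly two new
-- vertices. Suppose an optimal move e of Dominator is not fresh. Since e is legal it has a fresh neighbour f, and
-- since e has a covered endpoint, every edge newly dominated by e passes through the other endpoint of e, which
-- lies on f. So f dominates everything e does, and by the continuation principle (dominating more never hurts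
-- Dominator) f is optimal too. Hence the strategy that always plays a best fresh edge is optimal. Optimality is
-- measured against the backward-induction value of the game: a valid strategy guaranteeing k moves shows that
-- Dominator can force the end within k moves, and the fresh strategy achieves every such k.

module Submission where

open import Axiom.UniquenessOfIdentityProofs using (module Decidable⇒UIP)
open import Data.Bool as Bool using (Bool; T; _∨_)
open import Data.Bool.ListAction using (any)
open import Data.Bool.Properties using (T-≡; T-∨)
open import Data.Empty using (⊥-elim)
open import Data.Fin using (Fin; _≟_)
open import Data.Fin.Properties using (any?)
open import Data.Fin.Subset
  using (Subset; inside; outside; _∈_; _∉_; _⊂_; _─_; _-_; ∣_∣; ∁; Empty)
  renaming (⊥ to ∅)
open import Data.Fin.Subset.Properties
  using ( p─⊥≡p; p─q⊆p; x∈p∧x∉q⇒x∈p─q; x∈p∧x≢y⇒x∈p-y; x∈⁅x⁆; Empty-unique; ∣⊥∣≡0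
        ; p⊂q⇒∣p∣<∣q∣; p⊂q⇒∁p⊃∁q)
open import Data.List using (List; []; _∷_; _++_; [_]; _∷ʳ_; length; take)
open import Data.List.Properties using (length-++; take-all)
open import Data.List.Relation.Unary.Any as Any using (Any; here)
open import Data.List.Relation.Unary.Any.Properties using (any⁺; any⁻; Any-⊎⁻; ++⁺ˡ; ++⁺ʳ; ++⁻)
open import Data.Nat using (ℕ; zero; suc; _+_; _*_; _∸_; _≤_; _<_; s≤s)
open import Data.Nat.Induction using (<-wellFounded)
open import Data.Nat.Properties
  using (≤-refl; ≤-reflexive; m≤m+n; <⇒≤; <-≤-trans; ≮⇒≥; n≮0; m<1+n⇒m≤n; m<1+n⇒m<n∨m≡n
        ; +-comm; +-suc; *-suc; +-cancelˡ-≡; suc-injective; m+[n∸m]≡n)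
open import Data.Product using (Σ; ∃; _×_; _,_; proj₁; proj₂)
open import Data.Sum as Sum using (_⊎_; inj₁; inj₂)
open import Data.Maybe using (just; nothing)
open import Data.Vec using (_∷_; here; there; lookup)
open import Data.Vec.Properties using (lookup∘tabulate; lookup⇒[]=; []=⇒lookup)
open import Function using (id; _∘_; _⇔_; mk⇔; Equivalence)
open Equivalence using (to; from)
open import Induction.WellFounded using (Acc; acc)
open import Relation.Nullary using (¬_; Dec; yes; no; ¬?; contradiction)
open import Relation.Nullary.Decidable
  using (⌊_⌋; map′; _⊎-dec_; _×-dec_; _→-dec_; decidable-stable; toWitness; fromWitness)
open import Relation.Unary using (Decidable)
open import Relation.Binary.PropositionalEquality
  using (_≡_; _≢_; refl; sym; trans; cong; cong₂; subst; module ≡-Reasoning)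

import Defs as D
open D using (Graph; adj; irrefl; Strategy; start; dominator; staller)

Least : (ℕ → Set) → ℕ → Set
Least P k = P k × (∀ {i} → i < k → ¬ P i)

least-below : ∀ {P} → Decidable P → ∀ b → ∃ (Least P) ⊎ (∀ {i} → i < b → ¬ P i)
least-below P? zero = inj₂ λ ()
least-below P? (suc b) with least-below P? b
... | inj₁ least = inj₁ least
... | inj₂ none with P? b
...   | yes pb = inj₁ (b , pb , none)
...   | no ¬pb = inj₂ λ i<1+b → Sum.[ none , (λ { refl → ¬pb }) ] (m<1+n⇒m<n∨m≡n i<1+b)

least-witness : ∀ {P m} → Decidable P → P m → ∃ (Least P)
least-witness {m = m} P? pm = Sum.[ id , (λ none → contradiction pm (none ≤-refl)) ] (least-below P? (suc m))

take-++ˡ : ∀ {a} {A : Set a} i (xs ys : List A) → i ≤ length xs → take i (xs ++ ys) ≡ take i xs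
take-++ˡ zero    xs       ys _         = refl
take-++ˡ (suc i) (x ∷ xs) ys (s≤s i≤n) = cong (x ∷_) (take-++ˡ i xs ys i≤n)

length-∷ʳ : ∀ {a} {A : Set a} (xs : List A) x → length (xs ∷ʳ x) ≡ suc (length xs)
length-∷ʳ xs x = trans (length-++ xs) (+-comm (length xs) 1)

x∈p─q⇒x∉q : ∀ {n} {x : Fin n} {p q} → x ∈ p ─ q → x ∉ q
x∈p─q⇒x∉q {p = _ ∷ p} {outside ∷ q} here ()
x∈p─q⇒x∉q {p = _ ∷ p} {_ ∷ q} (there x∈) (there x∈q) = x∈p─q⇒x∉q x∈ x∈q

∣p∣≡1+∣p-x∣ : ∀ {n} {x : Fin n} {p} → x ∈ p → ∣ p ∣ ≡ suc ∣ p - x ∣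
∣p∣≡1+∣p-x∣ {p = inside ∷ p} here = cong (suc ∘ ∣_∣) (sym (p─⊥≡p p))
∣p∣≡1+∣p-x∣ {p = inside  ∷ p} (there x∈p) = cong suc (∣p∣≡1+∣p-x∣ x∈p)
∣p∣≡1+∣p-x∣ {p = outside ∷ p} (there x∈p) = ∣p∣≡1+∣p-x∣ x∈p

∣p∣≡2 : ∀ {n} {x y : Fin n} {p} → x ≢ y → x ∈ p → y ∈ p →
        (∀ {z} → z ∈ p → z ≡ x ⊎ z ≡ y) → ∣ p ∣ ≡ 2
∣p∣≡2 {n} {x} {y} {p} x≢y x∈p y∈p only = begin
  ∣ p ∣                 ≡⟨ ∣p∣≡1+∣p-x∣ x∈p ⟩
  suc ∣ p - x ∣         ≡⟨ cong suc (∣p∣≡1+∣p-x∣ (x∈p∧x≢y⇒x∈p-y y∈p (x≢y ∘ sym))) ⟩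
  2 + ∣ p - x - y ∣     ≡⟨ cong (λ q → 2 + ∣ q ∣) (Empty-unique nothing-else) ⟩
  2 + ∣ ∅ {n} ∣         ≡⟨ cong (2 +_) (∣⊥∣≡0 n) ⟩
  2                     ∎
  where
  open ≡-Reasoning
  nothing-else : Empty (p - x - y)
  nothing-else (z , z∈) with only (p─q⊆p _ _ (p─q⊆p _ _ z∈))
  ... | inj₁ refl = x∈p─q⇒x∉q (p─q⊆p _ _ z∈) (x∈⁅x⁆ z)
  ... | inj₂ refl = x∈p─q⇒x∉q z∈ (x∈⁅x⁆ z)

data Player : Set where
  Dominator Staller : Player

opponent : Player → Player
opponent Dominator = Staller
opponent Staller   = Dominator

turn : ℕ → Player
turn zero    = Dominator
turn (suc m) = opponent (turn m)

turn-even : ∀ {m} j → m ≡ 2 * j → turn m ≡ Dominator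
turn-even zero    refl = refl
turn-even (suc j) refl = trans (cong turn (*-suc 2 j)) (cong (opponent ∘ opponent) (turn-even j refl))

turn-odd : ∀ {m} j → m ≡ suc (2 * j) → turn m ≡ Staller
turn-odd j refl = cong opponent (turn-even j refl)

even≢odd : ∀ i j → 2 * i ≢ suc (2 * j)
even≢odd i j eq with trans (sym (turn-even i refl)) (turn-odd j eq)
... | ()

parity : ∀ m → ∃ λ j → m ≡ 2 * j ⊎ m ≡ suc (2 * j)
parity zero = 0 , inj₁ refl
parity (suc m) with parity m
... | j , inj₁ even = j , inj₂ (cong suc even)
... | j , inj₂ odd  = suc j , inj₁ (trans (cong suc odd) (sym (*-suc 2 j)))

module EdgeDominationGame {n : ℕ} (G : Graph n) where

  Edge : Set
  Edge = D.Edge G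

  History : Set
  History = D.History G

  src tgt : Edge → Fin n
  src = D.src G
  tgt = D.tgt G

  _∈ₑ_ : Fin n → Edge → Set
  _∈ₑ_ = D._∈ₑ_ G

  _∈N[_] : Edge → Edge → Set
  _∈N[_] = D._∈N[_] G

  Dominated : History → Edge → Set
  Dominated = D.Dominated G

  Legal : History → Edge → Set
  Legal = D.Legal G

  Finished : History → Set
  Finished = D.Finished G

  C : History → Subset n
  C = D.C G

  Covered : History → Fin n → Set
  Covered h x = Any (x ∈ₑ_) h

  src≢tgt : ∀ e → src e ≢ tgt e
  src≢tgt ((u , _) , uu) refl with trans (sym uu) (irrefl G u)
  ... | ()

  ∈N-refl : ∀ e → e ∈N[ e ]
  ∈N-refl e = inj₁ (inj₁ refl)

  shared-endpoint⇒∈N : ∀ {x f e} → x ∈ₑ f → x ∈ₑ e → f ∈N[ e ]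
  shared-endpoint⇒∈N (inj₁ refl) x∈e = inj₁ x∈e
  shared-endpoint⇒∈N (inj₂ refl) x∈e = inj₂ x∈e

  ∈N⇒shared-endpoint : ∀ {f e} → f ∈N[ e ] → ∃ λ x → x ∈ₑ f × x ∈ₑ e
  ∈N⇒shared-endpoint (inj₁ x∈e) = _ , inj₁ refl , x∈e
  ∈N⇒shared-endpoint (inj₂ x∈e) = _ , inj₂ refl , x∈e

  covered⇒dominated : ∀ {h x f} → x ∈ₑ f → Covered h x → Dominated h f
  covered⇒dominated {f = f} x∈f = Any.map λ {s} → shared-endpoint⇒∈N {f = f} {e = s} x∈f

  dominated⇒uncovered-endpoints-equal : ∀ {h e x y} → Dominated h e →
    x ∈ₑ e → ¬ Covered h x → y ∈ₑ e → ¬ Covered h y → x ≡ y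
  dominated⇒uncovered-endpoints-equal d (inj₁ refl) _   (inj₁ refl) _   = refl
  dominated⇒uncovered-endpoints-equal d (inj₂ refl) _   (inj₂ refl) _   = refl
  dominated⇒uncovered-endpoints-equal d (inj₁ refl) ¬cx (inj₂ refl) ¬cy =
    ⊥-elim (Sum.[ ¬cx , ¬cy ] (Any-⊎⁻ d))
  dominated⇒uncovered-endpoints-equal d (inj₂ refl) ¬cx (inj₁ refl) ¬cy =
    ⊥-elim (Sum.[ ¬cy , ¬cx ] (Any-⊎⁻ d))

  covers : Fin n → Edge → Bool
  covers x e = ⌊ x ≟ src e ⌋ ∨ ⌊ x ≟ tgt e ⌋

  T-covers : ∀ {x} e → T (covers x e) ⇔ x ∈ₑ e
  T-covers {x} e = mk⇔
    (Sum.map (toWitness {a? = x ≟ src e}) (toWitness {a? = x ≟ tgt e}) ∘ to T-∨)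
    (from T-∨ ∘ Sum.map (fromWitness {a? = x ≟ src e}) (fromWitness {a? = x ≟ tgt e}))

  lookup-C : ∀ h x → lookup (C h) x ≡ any (covers x) h
  lookup-C h = lookup∘tabulate (λ x → any (covers x) h)

  ∈C⇒covered : ∀ h {x} → x ∈ C h → Covered h x
  ∈C⇒covered h {x} x∈C = Any.map (λ {e} → to (T-covers e)) (any⁻ (covers x) h T-any)
    where
    T-any : T (any (covers x) h)
    T-any = from T-≡ (trans (sym (lookup-C h x)) ([]=⇒lookup x∈C))

  covered⇒∈C : ∀ h {x} → Covered h x → x ∈ C h
  covered⇒∈C h {x} c = lookup⇒[]= x (C h) (trans (lookup-C h x) (to T-≡ T-any))
    where
    T-any : T (any (covers x) h)
    T-any = any⁺ (covers x) (Any.map (λ {e} → from (T-covers e)) c)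

  C⊂C∷ʳ : ∀ {h} e → Legal h e → C h ⊂ C (h ∷ʳ e)
  C⊂C∷ʳ {h} e (f , f∈N[e] , ¬df) with ∈N⇒shared-endpoint {f} {e} f∈N[e]
  ... | x , x∈f , x∈e =
    (λ y∈C → covered⇒∈C (h ∷ʳ e) (++⁺ˡ (∈C⇒covered h y∈C))) ,
    x , covered⇒∈C (h ∷ʳ e) (++⁺ʳ h (here x∈e)) , ¬df ∘ covered⇒dominated {f = f} x∈f ∘ ∈C⇒covered h

  uncovered : History → ℕ
  uncovered h = ∣ ∁ (C h) ∣

  uncovered-shrinks : ∀ {h} e → Legal h e → uncovered (h ∷ʳ e) < uncovered h
  uncovered-shrinks e l = p⊂q⇒∣p∣<∣q∣ (p⊂q⇒∁p⊃∁q (C⊂C∷ʳ e l))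

  uncovered-∷ʳ-≤ : ∀ {h k} e → Legal h e → uncovered h ≤ suc k → uncovered (h ∷ʳ e) ≤ k
  uncovered-∷ʳ-≤ e l u≤ = m<1+n⇒m≤n (<-≤-trans (uncovered-shrinks e l) u≤)

  ∣C∷ʳ─C∣≡2 : ∀ {h e} → ¬ Dominated h e → ∣ C (h ∷ʳ e) ─ C h ∣ ≡ 2
  ∣C∷ʳ─C∣≡2 {h} {e} ¬de = ∣p∣≡2 (src≢tgt e) (new (inj₁ refl)) (new (inj₂ refl)) only
    where
    new : ∀ {x} → x ∈ₑ e → x ∈ C (h ∷ʳ e) ─ C h
    new x∈e = x∈p∧x∉q⇒x∈p─q (covered⇒∈C (h ∷ʳ e) (++⁺ʳ h (here x∈e)))
                             (¬de ∘ covered⇒dominated {f = e} x∈e ∘ ∈C⇒covered h)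
    only : ∀ {z} → z ∈ C (h ∷ʳ e) ─ C h → z ∈ₑ e
    only z∈ with ++⁻ h (∈C⇒covered (h ∷ʳ e) (p─q⊆p _ _ z∈))
    ... | inj₁ covered    = contradiction (covered⇒∈C h covered) (x∈p─q⇒x∉q z∈)
    ... | inj₂ (here z∈e) = z∈e

  ∃-edge? : ∀ {P : Edge → Set} → Decidable P → Dec (∃ P)
  ∃-edge? {P} P? =
    map′ (λ { (u , v , uv , p) → ((u , v) , uv) , p })
         (λ { (((u , v) , uv) , p) → u , v , uv , p })
         (any? λ u → any? λ v → at? u v)
    where
    open Decidable⇒UIP Bool._≟_ using (≡-irrelevant)
    at? : ∀ u v → Dec (Σ (adj G u v ≡ Bool.true) λ uv → P ((u , v) , uv))
    at? u v with adj G u v Bool.≟ Bool.true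
    ... | no ¬uv = no (¬uv ∘ proj₁)
    ... | yes uv = map′ (uv ,_)
                        (λ { (uv′ , p) → subst (λ q → P ((u , v) , q)) (≡-irrelevant uv′ uv) p })
                        (P? ((u , v) , uv))

  ∀-edge? : ∀ {P : Edge → Set} → Decidable P → Dec (∀ e → P e)
  ∀-edge? P? = map′ (λ ¬∃¬ e → decidable-stable (P? e) λ ¬p → ¬∃¬ (e , ¬p))
                    (λ ∀P → λ { (e , ¬p) → ¬p (∀P e) })
                    (¬? (∃-edge? (¬? ∘ P?)))

  ∈ₑ? : ∀ x e → Dec (x ∈ₑ e)
  ∈ₑ? x e = (x ≟ src e) ⊎-dec (x ≟ tgt e)

  ∈N? : ∀ f e → Dec (f ∈N[ e ])
  ∈N? f e = ∈ₑ? (src f) e ⊎-dec ∈ₑ? (tgt f) e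

  Dominated? : ∀ h f → Dec (Dominated h f)
  Dominated? h f = Any.any? (∈N? f) h

  Legal? : ∀ h e → Dec (Legal h e)
  Legal? h e = ∃-edge? λ f → ∈N? f e ×-dec ¬? (Dominated? h f)

  Finished? : ∀ h → Dec (Finished h)
  Finished? h = ∀-edge? (Dominated? h)

  finished-or-fresh : ∀ h → Finished h ⊎ ∃ λ f → ¬ Dominated h f
  finished-or-fresh h with ∃-edge? (¬? ∘ Dominated? h)
  ... | yes fresh = inj₂ fresh
  ... | no ¬fresh = inj₁ λ f → decidable-stable (Dominated? h f) λ ¬d → ¬fresh (f , ¬d)

  fresh⇒legal : ∀ {h} f → ¬ Dominated h f → Legal h f
  fresh⇒legal f ¬df = f , ∈N-refl f , ¬df

  finished⇒¬legal : ∀ {h} e → Finished h → ¬ Legal h e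
  finished⇒¬legal _ fin (f , _ , ¬df) = ¬df (fin f)

  -- Game values and the continuation principle

  Forces : Player → History → ℕ → Set
  Forces _         h zero    = Finished h
  Forces Dominator h (suc k) = Finished h ⊎ ∃ λ e → Legal h e × Forces Staller (h ∷ʳ e) k
  Forces Staller   h (suc k) = ∀ f → Legal h f → Forces Dominator (h ∷ʳ f) k

  Forces? : ∀ p h k → Dec (Forces p h k)
  Forces? _         h zero    = Finished? h
  Forces? Dominator h (suc k) =
    Finished? h ⊎-dec ∃-edge? λ e → Legal? h e ×-dec Forces? Staller (h ∷ʳ e) k
  Forces? Staller   h (suc k) = ∀-edge? λ f → Legal? h f →-dec Forces? Dominator (h ∷ʳ f) k

  finished⇒Forces : ∀ {p h} k → Finished h → Forces p h k
  finished⇒Forces             zero    fin     = fin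
  finished⇒Forces {Dominator} (suc k) fin     = inj₁ fin
  finished⇒Forces {Staller}   (suc k) fin f l = contradiction l (finished⇒¬legal f fin)

  Forces-mono : ∀ {p h k k′} → k ≤ k′ → Forces p h k → Forces p h k′
  Forces-mono {k = zero} {k′} _ fin = finished⇒Forces k′ fin
  Forces-mono {Dominator} {k = suc _} (s≤s _) (inj₁ fin) = inj₁ fin
  Forces-mono {Dominator} {k = suc _} (s≤s k≤k′) (inj₂ (e , l , w)) = inj₂ (e , l , Forces-mono k≤k′ w)
  Forces-mono {Staller}   {k = suc _} (s≤s k≤k′) w f l = Forces-mono k≤k′ (w f l)

  Forces-uncovered : ∀ {p h k} → uncovered h ≤ k → Forces p h k
  Forces-uncovered {p} {h} {zero} u≤0 with finished-or-fresh h
  ... | inj₁ fin       = fin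
  ... | inj₂ (f , ¬df) = contradiction (<-≤-trans (uncovered-shrinks f (fresh⇒legal f ¬df)) u≤0) n≮0
  Forces-uncovered {Dominator} {h} {suc k} u≤ with finished-or-fresh h
  ... | inj₁ fin       = inj₁ fin
  ... | inj₂ (f , ¬df) =
    inj₂ (f , fresh⇒legal f ¬df , Forces-uncovered (uncovered-∷ʳ-≤ f (fresh⇒legal f ¬df) u≤))
  Forces-uncovered {Staller} {k = suc _} u≤ f l = Forces-uncovered (uncovered-∷ʳ-≤ f l u≤)

  infix 4 _≼_
  record _≼_ (h h′ : History) : Set where
    constructor dominates
    field dominated : ∀ f → Dominated h f → Dominated h′ f
  open _≼_

  ≼-trans : ∀ {h h′ h″} → h ≼ h′ → h′ ≼ h″ → h ≼ h″
  ≼-trans h≼h′ h′≼h″ = dominates λ f → dominated h′≼h″ f ∘ dominated h≼h′ f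

  ≼-∷ʳ : ∀ {h e} → h ≼ h ∷ʳ e
  ≼-∷ʳ = dominates λ _ → ++⁺ˡ

  ∷ʳ-mono-≼ : ∀ {h h′ e} → h ≼ h′ → h ∷ʳ e ≼ h′ ∷ʳ e
  ∷ʳ-mono-≼ {h} {h′} h≼h′ = dominates λ f d → Sum.[ ++⁺ˡ ∘ dominated h≼h′ f , ++⁺ʳ h′ ] (++⁻ h d)

  illegal-∷ʳ-≼ : ∀ {h h′} e → h ≼ h′ → ¬ Legal h′ e → h ∷ʳ e ≼ h′
  illegal-∷ʳ-≼ {h} {h′} e h≼h′ ¬l = dominates dom
    where
    dom : ∀ f → Dominated (h ∷ʳ e) f → Dominated h′ f
    dom f d with ++⁻ h d
    ... | inj₁ dh            = dominated h≼h′ f dh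
    ... | inj₂ (here f∈N[e]) = decidable-stable (Dominated? h′ f) λ ¬d′ → ¬l (f , f∈N[e] , ¬d′)

  finished-≼ : ∀ {h h′} → h ≼ h′ → Finished h → Finished h′
  finished-≼ h≼h′ fin f = dominated h≼h′ f (fin f)

  legal-≼ : ∀ {h h′} e → h ≼ h′ → Legal h′ e → Legal h e
  legal-≼ _ h≼h′ (f , f∈N[e] , ¬d′) = f , f∈N[e] , ¬d′ ∘ dominated h≼h′ f

  continuation : ∀ {p h h′} k → h ≼ h′ → Forces p h k → Forces p h′ k
  continuation-extra-move : ∀ {p h h′} k → h ≼ h′ → Forces p h k → Forces (opponent p) h′ (suc k)

  continuation zero h≼h′ fin = finished-≼ h≼h′ fin
  continuation {Dominator} (suc k) h≼h′ (inj₁ fin) = inj₁ (finished-≼ h≼h′ fin)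
  continuation {Dominator} {h′ = h′} (suc k) h≼h′ (inj₂ (e , l , w)) with Legal? h′ e
  ... | yes l′ = inj₂ (e , l′ , continuation k (∷ʳ-mono-≼ h≼h′) w)
  -- e would dominate nothing new at h′, so Dominator may act as if she had already played it.
  ... | no ¬l′ = continuation-extra-move k (illegal-∷ʳ-≼ e h≼h′ ¬l′) w
  continuation {Staller} (suc k) h≼h′ w f l = continuation k (∷ʳ-mono-≼ h≼h′) (w f (legal-≼ f h≼h′ l))

  continuation-extra-move {Dominator} k h≼h′ w f _ = continuation k (≼-trans h≼h′ ≼-∷ʳ) w
  continuation-extra-move {Staller} {h′ = h′} k h≼h′ w with finished-or-fresh h′
  ... | inj₁ fin       = inj₁ fin
  ... | inj₂ (f , ¬df) = inj₂ (f , fresh⇒legal f ¬df , continuation k (≼-trans h≼h′ ≼-∷ʳ) w)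

  -- The fresh strategy and its optimality

  -- An edge newly dominated by e meets e in its only uncovered endpoint, which f shares.
  dominated-neighbour-≼ : ∀ {h} e f → Dominated h e → f ∈N[ e ] → ¬ Dominated h f →
                          h ∷ʳ e ≼ h ∷ʳ f
  dominated-neighbour-≼ {h} e f de f∈N[e] ¬df = dominates dom
    where
    dom : ∀ g → Dominated (h ∷ʳ e) g → Dominated (h ∷ʳ f) g
    dom g dg with ++⁻ h dg
    ... | inj₁ dhg = ++⁺ˡ dhg
    ... | inj₂ (here g∈N[e]) with Dominated? h g
    ...   | yes dhg = ++⁺ˡ dhg
    ...   | no ¬dhg with ∈N⇒shared-endpoint {g} {e} g∈N[e] | ∈N⇒shared-endpoint {f} {e} f∈N[e]
    ...     | y , y∈g , y∈e | w , w∈f , w∈e =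
      ++⁺ʳ h (here (shared-endpoint⇒∈N {f = g} {e = f} y∈g y∈f))
      where
      y≡w : y ≡ w
      y≡w = dominated⇒uncovered-endpoints-equal {e = e} de
              y∈e (¬dhg ∘ covered⇒dominated {f = g} y∈g) w∈e (¬df ∘ covered⇒dominated {f = f} w∈f)
      y∈f : y ∈ₑ f
      y∈f = subst (_∈ₑ f) (sym y≡w) w∈f

  fresh-replacement : ∀ {h k} e → Legal h e → Forces Staller (h ∷ʳ e) k →
                      ∃ λ e′ → ¬ Dominated h e′ × Forces Staller (h ∷ʳ e′) k
  fresh-replacement {h} {k} e (f , f∈N[e] , ¬df) w with Dominated? h e
  ... | no ¬de = e , ¬de , w
  ... | yes de = f , ¬df , continuation k (dominated-neighbour-≼ e f de f∈N[e] ¬df) w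

  ForcesFresh : History → ℕ → Set
  ForcesFresh h k = ∃ λ e → ¬ Dominated h e × Forces Staller (h ∷ʳ e) k

  BestFresh : History → Edge → Set
  BestFresh h e = ¬ Dominated h e × (∀ {k} → ForcesFresh h k → Forces Staller (h ∷ʳ e) k)

  ForcesFresh? : ∀ h → Decidable (ForcesFresh h)
  ForcesFresh? h k = ∃-edge? λ e → ¬? (Dominated? h e) ×-dec Forces? Staller (h ∷ʳ e) k

  best-fresh : ∀ {h} f → ¬ Dominated h f → ∃ (BestFresh h)
  best-fresh {h} f ¬df with least-witness (ForcesFresh? h) (f , ¬df , Forces-uncovered ≤-refl)
  ... | k , (e , ¬de , w) , least = e , ¬de , λ fk′ → Forces-mono (≮⇒≥ λ k′<k → least k′<k fk′) w

  σ : Strategy G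
  σ h with finished-or-fresh h
  ... | inj₁ _        = nothing
  ... | inj₂ (f , ¬df) = just (proj₁ (best-fresh f ¬df))

  σ-best : ∀ {h e} → σ h ≡ just e → BestFresh h e
  σ-best {h} σh with finished-or-fresh h
  σ-best refl | inj₂ (f , ¬df) = proj₂ (best-fresh f ¬df)

  σ-defined : ∀ {h} → ¬ Finished h → ∃ λ e → σ h ≡ just e
  σ-defined {h} ¬fin with finished-or-fresh h
  ... | inj₁ fin = contradiction fin ¬fin
  ... | inj₂ _   = _ , refl

  σ-valid : D.ValidStrategy G σ
  σ-valid _ _ _ _ ¬fin with σ-defined ¬fin
  ... | e , σh = e , σh , fresh⇒legal e (proj₁ (σ-best σh))

  σ-move-optimal : ∀ {h e k} → σ h ≡ just e → Forces Dominator h (suc k) → Forces Staller (h ∷ʳ e) k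
  σ-move-optimal {e = e} σh (inj₁ fin)          = contradiction (fin e) (proj₁ (σ-best σh))
  σ-move-optimal σh         (inj₂ (e′ , l , w)) = proj₂ (σ-best σh) (fresh-replacement e′ l w)

  Budget : ℕ → History → Set
  Budget k h = ∃ λ r → length h + r ≡ k × Forces (turn (length h)) h r

  budget-intro : ∀ {k h p r} → turn (length h) ≡ p → length h + r ≡ k → Forces p h r → Budget k h
  budget-intro refl eq w = _ , eq , w

  budget-elim : ∀ {k h p} → turn (length h) ≡ p → Budget k h → ∃ λ r → length h + r ≡ k × Forces p h r
  budget-elim refl b = b

  turn-∷ʳ : ∀ (h : History) e → turn (length (h ∷ʳ e)) ≡ opponent (turn (length h))
  turn-∷ʳ h e = cong turn (length-∷ʳ h e)

  length-∷ʳ-+ : ∀ (h : History) e r → length (h ∷ʳ e) + r ≡ length h + suc r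
  length-∷ʳ-+ h e r = trans (cong (_+ r) (length-∷ʳ h e)) (sym (+-suc (length h) r))

  budget-∷ʳ : ∀ {k h p r} e → turn (length h) ≡ p → length h + suc r ≡ k →
              Forces (opponent p) (h ∷ʳ e) r → Budget k (h ∷ʳ e)
  budget-∷ʳ {h = h} {r = r} e refl eq = budget-intro (turn-∷ʳ h e) (trans (length-∷ʳ-+ h e r) eq)

  budget-∷ʳ⁻ : ∀ {k h p} e → turn (length h) ≡ p → Budget k (h ∷ʳ e) →
               ∃ λ r → length h + suc r ≡ k × Forces (opponent p) (h ∷ʳ e) r
  budget-∷ʳ⁻ {h = h} e refl b with budget-elim (turn-∷ʳ h e) b
  ... | r , eq , w = r , trans (sym (length-∷ʳ-+ h e r)) eq , w

  σ-budget : ∀ {k h} → Forces Dominator [] k → D.Follows G σ h → Budget k h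
  σ-budget w start = _ , refl , w
  σ-budget w (dominator {e = e} fo j even σh l) with budget-elim (turn-even j even) (σ-budget w fo)
  ... | zero  , _  , fin = contradiction l (finished⇒¬legal e fin)
  ... | suc r , eq , wh  = budget-∷ʳ e (turn-even j even) eq (σ-move-optimal σh wh)
  σ-budget w (staller {e = e} fo j odd l) with budget-elim (turn-odd j odd) (σ-budget w fo)
  ... | zero  , _  , fin = contradiction l (finished⇒¬legal e fin)
  ... | suc r , eq , wh  = budget-∷ʳ e (turn-odd j odd) eq (wh e l)

  σ-guarantees : ∀ {k} → Forces Dominator [] k → D.Guarantees G σ k
  σ-guarantees w S fo _ with σ-budget w fo
  ... | r , eq , _ = subst (length S ≤_) eq (m≤m+n (length S) r)

  budget-finished : ∀ {k h} → length h ≤ k → Finished h → Budget k h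
  budget-finished {k} {h} le fin = k ∸ length h , m+[n∸m]≡n le , finished⇒Forces _ fin

  budget-by-move : ∀ {k h} e → turn (length h) ≡ Dominator → Legal h e → Budget k (h ∷ʳ e) → Budget k h
  budget-by-move e t l b with budget-∷ʳ⁻ e t b
  ... | r , eq , w = budget-intro t eq (inj₂ (e , l , w))

  budget-by-replies : ∀ {k h} f → turn (length h) ≡ Staller → Legal h f →
                      (∀ g → Legal h g → Budget k (h ∷ʳ g)) → Budget k h
  budget-by-replies {k} {h} f t lf after with budget-∷ʳ⁻ f t (after f lf)
  ... | r , eq , _ = budget-intro t eq reply
    where
    reply : ∀ g → Legal h g → Forces Dominator (h ∷ʳ g) r
    reply g lg with budget-∷ʳ⁻ g t (after g lg)
    ... | r′ , eq′ , w =
      subst (Forces Dominator (h ∷ʳ g)) (suc-injective (+-cancelˡ-≡ (length h) _ _ (trans eq′ (sym eq)))) w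

  τ-budget : ∀ {τ k} → D.ValidStrategy G τ → D.Guarantees G τ k →
             ∀ {h} → D.Follows G τ h → Budget k h
  τ-budget {τ} {k} valid guarantee = go (<-wellFounded _)
    where
    go : ∀ {h} → Acc _<_ (uncovered h) → D.Follows G τ h → Budget k h
    go {h} (acc later) fo with finished-or-fresh h | parity (length h)
    ... | inj₁ fin       | _             = budget-finished (guarantee h fo fin) fin
    ... | inj₂ (f , ¬df) | j , inj₁ even with valid h fo j even (λ fin → ¬df (fin f))
    ...   | e , τh , l = budget-by-move e (turn-even j even) l
                           (go (later (uncovered-shrinks e l)) (dominator fo j even τh l))
    go {h} (acc later) fo | inj₂ (f , ¬df) | j , inj₂ odd =
      budget-by-replies f (turn-odd j odd) (fresh⇒legal f ¬df)
        λ g l → go (later (uncovered-shrinks g l)) (staller fo j odd l)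

  σ-optimal : D.Optimal G σ
  σ-optimal = σ-valid , λ τ k valid guarantee → σ-guarantees (forces-from (τ-budget valid guarantee start))
    where
    forces-from : ∀ {k} → Budget k [] → Forces Dominator [] k
    forces-from (r , eq , w) = subst (Forces Dominator []) eq w

  newly-covered : History → ℕ → Subset n
  newly-covered S i = C (take (suc i) S) ─ C (take i S)

  newly-covered-∷ʳ : ∀ {i} h e → i < length h → newly-covered (h ∷ʳ e) i ≡ newly-covered h i
  newly-covered-∷ʳ {i} h e i<h =
    cong₂ (λ s t → C s ─ C t) (take-++ˡ (suc i) h [ e ] i<h) (take-++ˡ i h [ e ] (<⇒≤ i<h))

  newly-covered-last : ∀ h e → newly-covered (h ∷ʳ e) (length h) ≡ C (h ∷ʳ e) ─ C h
  newly-covered-last h e =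
    cong₂ (λ s t → C s ─ C t) (take-all _ (h ∷ʳ e) (≤-reflexive (length-∷ʳ h e)))
                              (trans (take-++ˡ _ h [ e ] ≤-refl) (take-all _ h ≤-refl))

  fresh-moves-cover-two : ∀ {τ} → (∀ {h e} → τ h ≡ just e → ¬ Dominated h e) →
    ∀ {S} → D.Follows G τ S → ∀ j → suc (2 * j) ≤ length S → ∣ newly-covered S (2 * j) ∣ ≡ 2
  fresh-moves-cover-two fresh (dominator {h} {e} fo _ _ τh _) j le
    with m<1+n⇒m<n∨m≡n (subst (2 * j <_) (length-∷ʳ h e) le)
  ... | inj₁ earlier =
    trans (cong ∣_∣ (newly-covered-∷ʳ h e earlier)) (fresh-moves-cover-two fresh fo j earlier)
  ... | inj₂ last    = begin
    ∣ newly-covered (h ∷ʳ e) (2 * j) ∣      ≡⟨ cong (λ i → ∣ newly-covered (h ∷ʳ e) i ∣) last ⟩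
    ∣ newly-covered (h ∷ʳ e) (length h) ∣  ≡⟨ cong ∣_∣ (newly-covered-last h e) ⟩
    ∣ C (h ∷ʳ e) ─ C h ∣                   ≡⟨ ∣C∷ʳ─C∣≡2 (fresh τh) ⟩
    2                                      ∎
    where open ≡-Reasoning
  fresh-moves-cover-two fresh (staller {h} {e} fo j′ odd _) j le
    with m<1+n⇒m<n∨m≡n (subst (2 * j <_) (length-∷ʳ h e) le)
  ... | inj₁ earlier =
    trans (cong ∣_∣ (newly-covered-∷ʳ h e earlier)) (fresh-moves-cover-two fresh fo j earlier)
  ... | inj₂ last    = contradiction (trans last odd) (even≢odd j j′)

open D using (Optimal; Follows; Finished; C)

proposition3 : ∀ {n} (G : Graph n) → ∃ λ σ → Optimal G σ ×
    (∀ S → Follows G σ S → Finished G S →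
    ∀ (j : ℕ) → suc (2 * j) ≤ length S →
    ∣ C G (take (suc (2 * j)) S) ─ C G (take (2 * j) S) ∣ ≡ 2)
proposition3 G = σ , σ-optimal , λ _ play _ → fresh-moves-cover-two (proj₁ ∘ σ-best) play
  where open EdgeDominationGame G
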